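{- For integers $N,k\ge0$ let $T(N,k)$ denote the number of tilings of an $N$-board using squares and $(1,1)$-fences that contain exactly $k$ fences (with $T(0,0)=1$). Let $\bar R(n,k)$ be the coefficient of $x^n$ in the power series expansion of $\dfrac{1}{(1-x)(1-x^2)}\left(\dfrac{x}{(1-x)^2}\right)^k$ (the $(n,k)$th entry of the Riordan array $(1/[(1-x)(1-x^2)],x/(1-x)^2)$). Then for all integers $0\le k\le n$, \[ T(2n+1,k)=\bar R(n,n-k). \]
   Context: An $N$-board is a $1\times N$ row of $N$ unit cells. A square is a $1\times1$ tile. A $(1,1)$-fence is a tile consisting of two $1\times1$ posts separated by a one-cell gap; placed on a board its posts occupy cells $i$ and $i+2$, and the gap cell must be covered by another tile. A tiling covers every cell exactly once. -}

module Defs where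

open import Data.Nat using (ℕ; zero; suc; _+_; _*_; _∸_; _≤_; _<?_; _≟_; _%_)
open import Data.Nat.Properties using ()
open import Data.Bool using (Bool; true; false; _∧_; if_then_else_)
open import Data.List using (List; []; _∷_; map; concatMap; filterᵇ; length; upTo)
open import Data.Nat.ListAction using (sum)
open import Data.Vec using (Vec; []; _∷_)
open import Data.Fin using (Fin; toℕ)
open import Relation.Nullary using (Dec; yes; no)
open import Relation.Nullary.Decidable using (⌊_⌋)

-- Role of a cell in a tiling by squares and (1,1)-fences.
--   sq    : the cell is covered by a square
--   postL : the cell is the left post of a fence (posts at i and i+2)
--   postR : the cell is the right post of a fence
data Cell : Set where
  sq postL postR : Cell

-- A cell assignment of an N-board: a word of length N over Cell.
-- It describes a tiling iff the fences pair up correctly: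
-- for every cell i, cell i is postL  ⇔  i+2 < N and cell i+2 is postR,
-- and cell i is postR  ⇔  i ≥ 2 and cell i-2 is postL.
-- (Each cell is then covered by exactly one tile: a square or one post
--  of a fence; gap cells are covered by whatever tile sits there.)

isL : Cell → Bool
isL postL = true
isL _ = false

isR : Cell → Bool
isR postR = true
isR _ = false

_⇔ᵇ_ : Bool → Bool → Bool
true ⇔ᵇ b = b
false ⇔ᵇ true = false
false ⇔ᵇ false = true

-- cell at position i (as Maybe-like: sq when out of range is irrelevant;
-- we use explicit bound checks)
at : ∀ {N} → Vec Cell N → ℕ → Cell
at [] _ = sq
at (c ∷ w) zero = c
at (c ∷ w) (suc i) = at w i

validAt : ∀ {N} → Vec Cell N → ℕ → Bool
validAt {N} w i =
  (isL (at w i) ⇔ᵇ (⌊ i + 2 <? N ⌋ ∧ isR (at w (i + 2))))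
  ∧ (isR (at w i) ⇔ᵇ (⌊ 1 <? i ⌋ ∧ isL (at w (i ∸ 2))))

allValid : ∀ {N} → Vec Cell N → Bool
allValid {N} w = go (upTo N)
  where
  go : List ℕ → Bool
  go [] = true
  go (i ∷ is) = validAt w i ∧ go is

-- number of fences = number of left posts
countL : ∀ {N} → Vec Cell N → ℕ
countL [] = 0
countL (c ∷ w) = (if isL c then 1 else 0) + countL w

words : (N : ℕ) → List (Vec Cell N)
words zero = [] ∷ []
words (suc N) = concatMap (λ w → (sq ∷ w) ∷ (postL ∷ w) ∷ (postR ∷ w) ∷ []) (words N)

T : ℕ → ℕ → ℕ
T N k = length (filterᵇ (λ w → allValid w ∧ ⌊ countL w ≟ k ⌋) (words N))

-- Formal power series over ℕ, given by their coefficient sequences.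
Series : Set
Series = ℕ → ℕ

_·_ : Series → Series → Series
(f · g) n = sum (map (λ i → f i * g (n ∸ i)) (upTo (suc n)))

-- 1/(1-x) = Σ x^n
geom : Series
geom _ = 1

-- 1/(1-x^2) = Σ x^{2n}
geom2 : Series
geom2 n = if ⌊ n % 2 ≟ 0 ⌋ then 1 else 0

-- x/(1-x)^2 = Σ n x^n
xOver1mx2 : Series
xOver1mx2 n = n

pow : Series → ℕ → Series
pow s zero zero = 1
pow s zero (suc _) = 0
pow s (suc k) = s · pow s k

Rbar : ℕ → ℕ → ℕ
Rbar n k = ((geom · geom2) · pow xOver1mx2 k) n

{-# OPTIONS --safe #-}
-- Read from left to right, a word is a tiling as soon as each cell agrees with what the two
-- preceding cells demand, so tilings are counted by a transfer recursion with states "cell 0 /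
-- cell 1 must be a right post". Recording fences by powers of y, the two one-sided states give
-- the same polynomial on even boards and differ by (−y)^q on boards of length 2q+1; eliminating
-- them, the rows r q = Σₖ T(2q+1,k) yᵏ satisfy r (q+2) − (1+2y) r (q+1) + y² r q = (−y)^(q+2).
-- On the Riordan side (1 − x)² maps each column to x times the previous one, which gives the
-- same recurrence for Rbar n (n − k) away from k = n; on the diagonal the correction (−y)^(q+2)
-- comes from column 0, whose entries ⌊n/2⌋ + 1 grow with the parity of n. Both families agree
-- on the first two rows, so they coincide.
module Submission where

open import Defs
open import Data.Nat using (ℕ; zero; suc; _+_; _*_; _∸_; _%_; _≤_; _<_; s≤s; _<?_; _≤?_; _≟_; _<ᵇ_; _≡ᵇ_)
open import Data.Bool using (Bool; true; false; _∧_; not; if_then_else_)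
open import Data.Bool.Properties using (∧-assoc; ∧-comm; ∧-zeroʳ)
open import Data.Bool.ListAction using (and; all)
open import Data.List using (List; []; _∷_; length; map; filterᵇ; concatMap; upTo)
open import Data.Nat.Properties
  using (+-identityʳ; +-assoc; +-comm; +-cancelʳ-≡; *-identityˡ; *-identityʳ; *-zeroʳ; *-distribʳ-+; +-commutativeSemigroup;
         m+n≡0⇒m≡0; <⇒≤; n≤1+n; n<1+n; <⇒≱; ≤-refl; n∸n≡0; +-∸-assoc; <-cmp; >⇒≢; <⇒≢; m<n⇒m<1+n)
open import Data.Nat.DivMod using ([m+n]%n≡m%n)
open import Algebra.Properties.CommutativeSemigroup +-commutativeSemigroup using (interchange)
open import Data.Nat.ListAction using (sum)
open import Data.Nat.Tactic.RingSolver using (solve-∀)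
open import Data.List.Properties using (map-applyUpTo; map-upTo; map-cong; foldr-universal; foldr-map)
open import Data.Vec using (Vec; []; _∷_)
open import Function using (_∘_)
open import Relation.Binary.PropositionalEquality
open import Relation.Nullary.Decidable using (⌊_⌋; does; isYes≗does; dec-true; dec-false)
open import Relation.Nullary.Negation using (contradiction)
open import Relation.Binary.Definitions using (tri<; tri≈; tri>)

-- Tilings as a left-to-right check

⇔ᵇ-comm : ∀ x y → (x ⇔ᵇ y) ≡ (y ⇔ᵇ x)
⇔ᵇ-comm true  true  = refl
⇔ᵇ-comm true  false = refl
⇔ᵇ-comm false true  = refl
⇔ᵇ-comm false false = refl

all-universal : ∀ {p : ℕ → Bool} (h : List ℕ → Bool) → h [] ≡ true →
                (∀ i is → h (i ∷ is) ≡ p i ∧ h is) → ∀ is → h is ≡ all p is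
all-universal {p} h h[] h∷ is =
  trans (foldr-universal h (λ i b → p i ∧ b) true h[] h∷ is) (sym (foldr-map _∧_ p true is))

all-cong : ∀ {p q : ℕ → Bool} → (∀ i → p i ≡ q i) → ∀ is → all p is ≡ all q is
all-cong p≗q is = cong and (map-cong p≗q is)

map-upTo-suc : ∀ {A : Set} (h : ℕ → A) n → map h (upTo (suc n)) ≡ h 0 ∷ map (h ∘ suc) (upTo n)
map-upTo-suc h n = cong (h 0 ∷_) (trans (map-applyUpTo suc h n) (sym (map-upTo (h ∘ suc) n)))

all-upTo-suc : ∀ (p : ℕ → Bool) n → all p (upTo (suc n)) ≡ p 0 ∧ all (p ∘ suc) (upTo n)
all-upTo-suc p n = cong and (map-upTo-suc p n)

-- allValid folds a function local to its definition over upTo N; abstracting upTo N exposes it.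
allValid-all : ∀ {N} (w : Vec Cell N) → allValid w ≡ all (validAt w) (upTo N)
allValid-all {N} w = generalise-upTo (all-universal _ refl (λ _ _ → refl))
  where
  generalise-upTo : (∀ is → _ ≡ all (validAt w) is) → allValid w ≡ all (validAt w) (upTo N)
  generalise-upTo h with upTo N
  ... | is = h is

-- tiles a b w: w tiles its board when cell 0 (if a) and cell 1 (if b) must in addition be
-- right posts of fences whose left posts lie before the board.
tiles : ∀ {N} → Bool → Bool → Vec Cell N → Bool
tiles a b []      = not a ∧ not b
tiles a b (c ∷ w) = (isR c ⇔ᵇ a) ∧ tiles b (isL c) w

-- validAt for the board preceded by two virtual cells, which are left posts iff a, resp. b.
postLTwoBefore : ∀ {N} → Bool → Bool → Vec Cell N → ℕ → Bool
postLTwoBefore a b w zero          = a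
postLTwoBefore a b w (suc zero)    = b
postLTwoBefore a b w (suc (suc i)) = isL (at w i)

validIn : ∀ {N} → Bool → Bool → Vec Cell N → ℕ → Bool
validIn a b w i = (isR (at w i) ⇔ᵇ postLTwoBefore a b w i) ∧ (isL (at w i) ⇔ᵇ isR (at w (i + 2)))

rightPostsAtStart : ∀ {N} → Bool → Bool → Vec Cell N → Bool
rightPostsAtStart a b w = (isR (at w 0) ⇔ᵇ a) ∧ (isR (at w 1) ⇔ᵇ b)

-- at is sq outside the board, so the bound checks in validAt are redundant.
inBounds-isR : ∀ {N} (w : Vec Cell N) i → (i <ᵇ N) ∧ isR (at w i) ≡ isR (at w i)
inBounds-isR []      i       = refl
inBounds-isR (c ∷ w) zero    = refl
inBounds-isR (c ∷ w) (suc i) = inBounds-isR w i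

postLTwoBefore-free : ∀ {N} (w : Vec Cell N) i → ⌊ 1 <? i ⌋ ∧ isL (at w (i ∸ 2)) ≡ postLTwoBefore false false w i
postLTwoBefore-free w zero          = refl
postLTwoBefore-free w (suc zero)    = refl
postLTwoBefore-free w (suc (suc i)) = refl

validAt≡validIn : ∀ {N} (w : Vec Cell N) i → validAt w i ≡ validIn false false w i
validAt≡validIn w i = trans
  (cong₂ (λ x y → (isL (at w i) ⇔ᵇ x) ∧ (isR (at w i) ⇔ᵇ y))
         (trans (cong (_∧ isR (at w (i + 2))) (isYes≗does (i + 2 <? _))) (inBounds-isR w (i + 2)))
         (postLTwoBefore-free w i))
  (∧-comm (isL (at w i) ⇔ᵇ isR (at w (i + 2))) _)

validIn-∷ : ∀ {N} a b c (w : Vec Cell N) i → validIn a b (c ∷ w) (suc i) ≡ validIn b (isL c) w i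
validIn-∷ a b c w zero          = refl
validIn-∷ a b c w (suc zero)    = refl
validIn-∷ a b c w (suc (suc i)) = refl

∧-absorb : ∀ p q r s → p ∧ ((q ∧ r) ∧ s) ≡ (p ∧ q) ∧ ((p ∧ r) ∧ s)
∧-absorb true  q r s = ∧-assoc q r s
∧-absorb false q r s = refl

∧-absorb₂ : ∀ p q x y z → (p ∧ q) ∧ ((p ∧ x) ∧ ((q ∧ y) ∧ z)) ≡ (p ∧ x) ∧ ((q ∧ y) ∧ z)
∧-absorb₂ false q     x y z = refl
∧-absorb₂ true  true  x y z = refl
∧-absorb₂ true  false x y z = sym (∧-zeroʳ x)

tiles≡allValidIn : ∀ {N} a b (w : Vec Cell N) →
                   tiles a b w ≡ rightPostsAtStart a b w ∧ all (validIn a b w) (upTo N)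
tiles≡allValidIn false false [] = refl
tiles≡allValidIn false true  [] = refl
tiles≡allValidIn true  false [] = refl
tiles≡allValidIn true  true  [] = refl
tiles≡allValidIn {suc N} a b (c ∷ w) = begin
  (isR c ⇔ᵇ a) ∧ tiles b (isL c) w
    ≡⟨ cong ((isR c ⇔ᵇ a) ∧_) (tiles≡allValidIn b (isL c) w) ⟩
  (isR c ⇔ᵇ a) ∧ (((isR (at w 0) ⇔ᵇ b) ∧ (isR (at w 1) ⇔ᵇ isL c)) ∧ all (validIn b (isL c) w) (upTo N))
    ≡⟨ ∧-absorb (isR c ⇔ᵇ a) _ _ _ ⟩
  ((isR c ⇔ᵇ a) ∧ (isR (at w 0) ⇔ᵇ b)) ∧ (((isR c ⇔ᵇ a) ∧ (isR (at w 1) ⇔ᵇ isL c)) ∧ all (validIn b (isL c) w) (upTo N))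
    ≡⟨ cong₂ (λ x y → ((isR c ⇔ᵇ a) ∧ (isR (at w 0) ⇔ᵇ b)) ∧ (((isR c ⇔ᵇ a) ∧ x) ∧ y))
             (⇔ᵇ-comm (isR (at w 1)) (isL c)) (all-cong (sym ∘ validIn-∷ a b c w) (upTo N)) ⟩
  rightPostsAtStart a b (c ∷ w) ∧ (validIn a b (c ∷ w) 0 ∧ all (validIn a b (c ∷ w) ∘ suc) (upTo N))
    ≡⟨ cong (rightPostsAtStart a b (c ∷ w) ∧_) (sym (all-upTo-suc (validIn a b (c ∷ w)) N)) ⟩
  rightPostsAtStart a b (c ∷ w) ∧ all (validIn a b (c ∷ w)) (upTo (suc N)) ∎
  where open ≡-Reasoning

allValid≡tiles : ∀ {N} (w : Vec Cell N) → allValid w ≡ tiles false false w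
allValid≡tiles {N} w = begin
  allValid w                                ≡⟨ allValid-all w ⟩
  all (validAt w) (upTo N)                  ≡⟨ all-cong (validAt≡validIn w) (upTo N) ⟩
  all (validIn false false w) (upTo N)      ≡⟨ sym (rightPostsAtStart-free w) ⟩
  rightPostsAtStart false false w ∧ all (validIn false false w) (upTo N)
                                            ≡⟨ sym (tiles≡allValidIn false false w) ⟩
  tiles false false w                       ∎
  where
  open ≡-Reasoning
  rightPostsAtStart-free : ∀ {N} (w : Vec Cell N) →
    rightPostsAtStart false false w ∧ all (validIn false false w) (upTo N) ≡ all (validIn false false w) (upTo N)
  rightPostsAtStart-free []              = refl
  rightPostsAtStart-free (sq ∷ [])       = refl
  rightPostsAtStart-free (postL ∷ [])    = refl
  rightPostsAtStart-free (postR ∷ [])    = refl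
  rightPostsAtStart-free (c ∷ d ∷ w)     = ∧-absorb₂ (isR c ⇔ᵇ false) (isR d ⇔ᵇ false) _ _ _

-- Counting by a transfer recursion

indicator : Bool → ℕ
indicator b = if b then 1 else 0

count : ∀ {A : Set} → (A → Bool) → List A → ℕ
count p []       = 0
count p (x ∷ xs) = indicator (p x) + count p xs

length-filterᵇ : ∀ {A : Set} (p : A → Bool) xs → length (filterᵇ p xs) ≡ count p xs
length-filterᵇ p []       = refl
length-filterᵇ p (x ∷ xs) with p x
... | true  = cong suc (length-filterᵇ p xs)
... | false = length-filterᵇ p xs

count-cong : ∀ {A : Set} {p q : A → Bool} → (∀ x → p x ≡ q x) → ∀ xs → count p xs ≡ count q xs
count-cong p≗q []       = refl
count-cong p≗q (x ∷ xs) = cong₂ _+_ (cong indicator (p≗q x)) (count-cong p≗q xs)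

count-false : ∀ {A : Set} (xs : List A) → count (λ _ → false) xs ≡ 0
count-false []       = refl
count-false (x ∷ xs) = count-false xs

count-words-suc : ∀ N (p : Vec Cell (suc N) → Bool) →
  count p (words (suc N)) ≡ count (p ∘ (sq ∷_)) (words N) + count (p ∘ (postL ∷_)) (words N) + count (p ∘ (postR ∷_)) (words N)
count-words-suc N p = go (words N)
  where
  regroup : ∀ a b c x y z → a + (b + (c + (x + y + z))) ≡ (a + x) + (b + y) + (c + z)
  regroup = solve-∀
  go : ∀ ws → count p (concatMap (λ w → (sq ∷ w) ∷ (postL ∷ w) ∷ (postR ∷ w) ∷ []) ws)
              ≡ count (p ∘ (sq ∷_)) ws + count (p ∘ (postL ∷_)) ws + count (p ∘ (postR ∷_)) ws
  go []       = refl
  go (w ∷ ws) =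
    trans (cong (λ n → ext sq + (ext postL + (ext postR + n))) (go ws)) (regroup (ext sq) (ext postL) (ext postR) _ _ _)
    where
    ext : Cell → ℕ
    ext c = indicator (p (c ∷ w))

-- A row r : ℕ → ℕ stands for the polynomial Σ r k yᵏ, y counting fences; shift multiplies by y.
shift : (ℕ → ℕ) → ℕ → ℕ
shift r zero    = 0
shift r (suc k) = r k

shift-cong : ∀ {f g : ℕ → ℕ} → (∀ k → f k ≡ g k) → ∀ k → shift f k ≡ shift g k
shift-cong f≗g zero    = refl
shift-cong f≗g (suc k) = f≗g k

tilings : Bool → Bool → ℕ → ℕ → ℕ
tilings a     b     zero    k    = indicator ((not a ∧ not b) ∧ (0 ≡ᵇ k))
tilings true  b     (suc N) k    = tilings b false N k
tilings false b     (suc N) k    = tilings b false N k + shift (tilings b true N) k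

count-tiles : ∀ N a b k → count (λ w → tiles a b w ∧ (countL w ≡ᵇ k)) (words N) ≡ tilings a b N k
count-tiles zero a b k = +-identityʳ _
count-tiles (suc N) true b k = begin
  count (λ w → tiles true b w ∧ (countL w ≡ᵇ k)) (words (suc N))
    ≡⟨ count-words-suc N (λ w → tiles true b w ∧ (countL w ≡ᵇ k)) ⟩
  count (λ _ → false) (words N) + count (λ _ → false) (words N) + count (λ w → tiles b false w ∧ (countL w ≡ᵇ k)) (words N)
    ≡⟨ cong₂ (λ m n → m + m + n) (count-false (words N)) (count-tiles N b false k) ⟩
  tilings b false N k ∎
  where open ≡-Reasoning
count-tiles (suc N) false b k = begin
  count (λ w → tiles false b w ∧ (countL w ≡ᵇ k)) (words (suc N))
    ≡⟨ count-words-suc N (λ w → tiles false b w ∧ (countL w ≡ᵇ k)) ⟩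
  count (λ w → tiles b false w ∧ (countL w ≡ᵇ k)) (words N) + count (λ w → tiles b true w ∧ (suc (countL w) ≡ᵇ k)) (words N)
    + count (λ _ → false) (words N)
    ≡⟨ cong₂ _+_ (cong₂ _+_ (count-tiles N b false k) (count-fence k)) (count-false (words N)) ⟩
  tilings b false N k + shift (tilings b true N) k + 0
    ≡⟨ +-identityʳ _ ⟩
  tilings false b (suc N) k ∎
  where
  open ≡-Reasoning
  count-fence : ∀ k → count (λ w → tiles b true w ∧ (suc (countL w) ≡ᵇ k)) (words N) ≡ shift (tilings b true N) k
  count-fence zero    = trans (count-cong (λ w → ∧-zeroʳ (tiles b true w)) (words N)) (count-false (words N))
  count-fence (suc k) = count-tiles N b true k

T≡tilings : ∀ N k → T N k ≡ tilings false false N k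
T≡tilings N k = begin
  T N k
    ≡⟨ length-filterᵇ _ (words N) ⟩
  count (λ w → allValid w ∧ ⌊ countL w ≟ k ⌋) (words N)
    ≡⟨ count-cong (λ w → cong₂ _∧_ (allValid≡tiles w) (isYes≗does (countL w ≟ k))) (words N) ⟩
  count (λ w → tiles false false w ∧ (countL w ≡ᵇ k)) (words N)
    ≡⟨ count-tiles N false false k ⟩
  tilings false false N k ∎
  where open ≡-Reasoning

-- Boards of odd length

double : ℕ → ℕ
double zero    = 0
double (suc q) = suc (suc (double q))

2n+1≡suc-double : ∀ n → 2 * n + 1 ≡ suc (double n)
2n+1≡suc-double zero    = refl
2n+1≡suc-double (suc n) = trans (step n) (cong (2 +_) (2n+1≡suc-double n))
  where
  step : ∀ n → 2 * suc n + 1 ≡ 2 + (2 * n + 1)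
  step = solve-∀

δ : ℕ → ℕ → ℕ
δ zero    zero    = 1
δ zero    (suc k) = 0
δ (suc q) zero    = 0
δ (suc q) (suc k) = δ q k

δ-≢ : ∀ {q k} → q ≢ k → δ q k ≡ 0
δ-≢ {zero}  {zero}  q≢k = contradiction refl q≢k
δ-≢ {zero}  {suc k} _   = refl
δ-≢ {suc q} {zero}  _   = refl
δ-≢ {suc q} {suc k} q≢k = δ-≢ (q≢k ∘ cong suc)

δ-diagonal : ∀ q → δ q q ≡ 1
δ-diagonal zero    = refl
δ-diagonal (suc q) = δ-diagonal q

-- δ q k * evenBit q and δ q k * oddBit q are the positive and negative part of [yᵏ] (−y)^q.
evenBit oddBit : ℕ → ℕ
evenBit zero    = 1
evenBit (suc q) = oddBit q
oddBit  zero    = 0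
oddBit  (suc q) = evenBit q

tilings-swap-even : ∀ q k → tilings false true (double q) k ≡ tilings true false (double q) k
tilings-swap-even zero    k = refl
tilings-swap-even (suc q) k = cong (tilings false false (double q) k +_) (shift-cong (sym ∘ tilings-swap-even q) k)

tilings-swap-odd : ∀ q k → tilings true false (suc (double q)) k + δ q k * oddBit q
                         ≡ tilings false true (suc (double q)) k + δ q k * evenBit q
tilings-swap-odd zero    zero    = refl
tilings-swap-odd zero    (suc k) = refl
tilings-swap-odd (suc q) zero    = refl
tilings-swap-odd (suc q) (suc k) = begin
  t + tilings false true N k + δ q k * evenBit q    ≡⟨ +-assoc t _ _ ⟩
  t + (tilings false true N k + δ q k * evenBit q)  ≡⟨ cong (t +_) (sym (tilings-swap-odd q k)) ⟩
  t + (tilings true false N k + δ q k * oddBit q)   ≡⟨ sym (+-assoc t _ _) ⟩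
  t + tilings true false N k + δ q k * oddBit q     ∎
  where
  open ≡-Reasoning
  N = suc (double q)
  t = tilings false false N (suc k)

-- [yᵏ] of r (2+q) − (1+2y) r (1+q) + y² r q = (−y)^(2+q), with all subtractions moved across.
RowRecurrenceAt : (ℕ → ℕ → ℕ) → ℕ → ℕ → Set
RowRecurrenceAt r q k = r (2 + q) k + shift (shift (r q)) k + δ (2 + q) k * oddBit q
                      ≡ r (1 + q) k + 2 * shift (r (1 + q)) k + δ (2 + q) k * evenBit q

RowRecurrence : (ℕ → ℕ → ℕ) → Set
RowRecurrence r = ∀ q k → RowRecurrenceAt r q k

RowRecurrence-unique : ∀ {r s} → RowRecurrence r → RowRecurrence s →
                       (∀ k → r 0 k ≡ s 0 k) → (∀ k → r 1 k ≡ s 1 k) → ∀ q k → r q k ≡ s q k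
RowRecurrence-unique {r} {s} rec-r rec-s r₀≗s₀ r₁≗s₁ = unique
  where
  unique : ∀ q k → r q k ≡ s q k
  unique zero          = r₀≗s₀
  unique (suc zero)    = r₁≗s₁
  unique (suc (suc q)) k = +-cancelʳ-≡ Z _ _ (+-cancelʳ-≡ D _ _ (begin
    r (2 + q) k + Z + D                       ≡⟨ cong (λ z → r (2 + q) k + z + D) (shift-cong (shift-cong (sym ∘ unique q)) k) ⟩
    r (2 + q) k + shift (shift (r q)) k + D   ≡⟨ rec-r q k ⟩
    r (1 + q) k + 2 * shift (r (1 + q)) k + E ≡⟨ cong₂ (λ a b → a + 2 * b + E) (unique (suc q) k) (shift-cong (unique (suc q)) k) ⟩
    s (1 + q) k + 2 * shift (s (1 + q)) k + E ≡⟨ sym (rec-s q k) ⟩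
    s (2 + q) k + Z + D                       ∎))
    where
    open ≡-Reasoning
    Z = shift (shift (s q)) k
    D = δ (2 + q) k * oddBit q
    E = δ (2 + q) k * evenBit q

tilings-recurrence : RowRecurrence (λ q → tilings false false (suc (double q)))
tilings-recurrence q zero = no-fences (tilings false false (3 + double q) 0)
  where
  no-fences : ∀ x → x + 0 + 0 + 0 + 0 ≡ x + 2 * 0 + 0
  no-fences = solve-∀
-- Two more unfolding steps reduce the claim to the odd swap identity at length 2q+3.
tilings-recurrence q (suc k) = begin
  x + u₂ + u₃ + s + B     ≡⟨ cong (λ z → x + u₂ + z + s + B) u₃≡t₂ ⟩
  x + u₂ + t₂ + s + B     ≡⟨ regroup₁ x u₂ t₂ s B ⟩
  x + t₂ + (s + (u₂ + B)) ≡⟨ cong (λ z → x + t₂ + (s + z)) (sym (tilings-swap-odd (suc q) k)) ⟩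
  x + t₂ + (s + (c₂ + A)) ≡⟨ regroup₂ x t₂ s c₂ A ⟩
  x + t₂ + (c₂ + s) + A   ≡⟨ cong (λ z → x + t₂ + z + A) (sym t₂≡c₂+s) ⟩
  x + t₂ + t₂ + A         ≡⟨ regroup₃ x t₂ A ⟩
  x + 2 * t₂ + A          ∎
  where
  open ≡-Reasoning
  N  = suc (double q)
  x  = tilings false false (2 + N) (suc k)
  s  = shift (tilings false false N) k
  t₂ = tilings false false (2 + N) k
  c₂ = tilings true  false (2 + N) k
  u₂ = tilings false true  (2 + N) k
  u₃ = tilings false true  (3 + N) k
  A  = δ (suc q) k * evenBit q
  B  = δ (suc q) k * oddBit q
  u₃≡t₂ : u₃ ≡ t₂
  u₃≡t₂ = tilings-swap-even (2 + q) k
  t₂≡c₂+s : t₂ ≡ c₂ + s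
  t₂≡c₂+s = cong (c₂ +_) (shift-cong (tilings-swap-even (suc q)) k)
  regroup₁ : ∀ x u t s b → x + u + t + s + b ≡ x + t + (s + (u + b))
  regroup₁ = solve-∀
  regroup₂ : ∀ x t s c a → x + t + (s + (c + a)) ≡ x + t + (c + s) + a
  regroup₂ = solve-∀
  regroup₃ : ∀ x t a → x + t + t + a ≡ x + 2 * t + a
  regroup₃ = solve-∀

-- The Riordan array

sum-map-+ : ∀ {A : Set} (f g : A → ℕ) xs → sum (map (λ x → f x + g x) xs) ≡ sum (map f xs) + sum (map g xs)
sum-map-+ f g []       = refl
sum-map-+ f g (x ∷ xs) = trans (cong (f x + g x +_) (sum-map-+ f g xs)) (interchange (f x) (g x) _ _)

·-suc : ∀ (f g : Series) n → (f · g) (suc n) ≡ f 0 * g (suc n) + ((f ∘ suc) · g) n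
·-suc f g n = cong sum (map-upTo-suc (λ i → f i * g (suc n ∸ i)) (suc n))

·-distribʳ-+ : ∀ (f g h : Series) n → ((λ i → f i + g i) · h) n ≡ (f · h) n + (g · h) n
·-distribʳ-+ f g h n =
  trans (cong sum (map-cong (λ i → *-distribʳ-+ (h (n ∸ i)) (f i) (g i)) (upTo (suc n))))
        (sum-map-+ (λ i → f i * h (n ∸ i)) (λ i → g i * h (n ∸ i)) (upTo (suc n)))

·-identityʳ : ∀ (f : Series) n → (f · pow xOver1mx2 0) n ≡ f n
·-identityʳ f zero    = trans (+-identityʳ _) (*-identityʳ (f 0))
·-identityʳ f (suc n) = trans (·-suc f (pow xOver1mx2 0) n) (cong₂ _+_ (*-zeroʳ (f 0)) (·-identityʳ (f ∘ suc) n))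

-- Coefficientwise; equivalently u = xOver1mx2 · v.
record [1-x]²_≡x·_ (u v : Series) : Set where
  field
    coeff₀  : u 0 ≡ 0
    coeff₁  : u 1 ≡ v 0
    coeff₂₊ : ∀ n → u (2 + n) + u n ≡ v (1 + n) + 2 * u (1 + n)
open [1-x]²_≡x·_

xOver1mx2·-solves : ∀ v → [1-x]² (xOver1mx2 · v) ≡x· v
xOver1mx2·-solves v = record { coeff₀ = refl ; coeff₁ = first (v 0) (v 1) ; coeff₂₊ = second-difference }
  where
  open ≡-Reasoning
  first : ∀ a b → 0 * b + (1 * a + 0) ≡ a
  first = solve-∀
  partialSum-suc : ∀ n → (geom · v) (suc n) ≡ (geom · v) n + v (suc n)
  partialSum-suc n = trans (·-suc geom v n) (trans (cong (_+ (geom · v) n) (*-identityˡ (v (suc n)))) (+-comm (v (suc n)) _))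
  xOver1mx2·-suc : ∀ n → (xOver1mx2 · v) (suc n) ≡ (xOver1mx2 · v) n + (geom · v) n
  xOver1mx2·-suc n = trans (·-suc xOver1mx2 v n) (trans (·-distribʳ-+ geom xOver1mx2 v n) (+-comm ((geom · v) n) _))
  second-difference : ∀ n → (xOver1mx2 · v) (2 + n) + (xOver1mx2 · v) n
                            ≡ v (1 + n) + 2 * (xOver1mx2 · v) (1 + n)
  second-difference n = begin
    u₂ + u₀                  ≡⟨ cong (_+ u₀) (xOver1mx2·-suc (suc n)) ⟩
    u₁ + (geom · v) (suc n) + u₀ ≡⟨ cong (λ z → u₁ + z + u₀) (partialSum-suc n) ⟩
    u₁ + (S + v (suc n)) + u₀    ≡⟨ regroup u₁ S (v (suc n)) u₀ ⟩
    v (suc n) + (u₁ + (u₀ + S))  ≡⟨ cong (λ z → v (suc n) + (u₁ + z)) (sym (xOver1mx2·-suc n)) ⟩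
    v (suc n) + (u₁ + u₁)        ≡⟨ cong (λ z → v (suc n) + (u₁ + z)) (sym (+-identityʳ u₁)) ⟩
    v (suc n) + 2 * u₁           ∎
    where
    u₀ = (xOver1mx2 · v) n
    u₁ = (xOver1mx2 · v) (suc n)
    u₂ = (xOver1mx2 · v) (suc (suc n))
    S  = (geom · v) n
    regroup : ∀ a s w b → a + (s + w) + b ≡ w + (a + (b + s))
    regroup = solve-∀

·-preserves-[1-x]²≡x· : ∀ f {u v} → [1-x]² u ≡x· v → [1-x]² (f · u) ≡x· (f · v)
·-preserves-[1-x]²≡x· f {u} {v} uv = record { coeff₀ = c₀ f ; coeff₁ = c₁ f ; coeff₂₊ = c₂₊ f }
  where
  open ≡-Reasoning
  c₀ : ∀ f → (f · u) 0 ≡ 0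
  c₀ f = trans (cong (λ a → f 0 * a + 0) (coeff₀ uv)) (cong (_+ 0) (*-zeroʳ (f 0)))
  c₁ : ∀ f → (f · u) 1 ≡ (f · v) 0
  c₁ f = trans (cong₂ (λ a b → f 0 * a + (f 1 * b + 0)) (coeff₁ uv) (coeff₀ uv))
               (cong (λ z → f 0 * v 0 + (z + 0)) (*-zeroʳ (f 1)))
  combine : ∀ c a b a′ b′ x y x′ y′ → a + b ≡ a′ + 2 * b′ → x + y ≡ x′ + 2 * y′ →
            (c * a + x) + (c * b + y) ≡ (c * a′ + x′) + 2 * (c * b′ + y′)
  combine c a b a′ b′ x y x′ y′ ab xy = begin
    (c * a + x) + (c * b + y)          ≡⟨ distribute c a b x y ⟩
    c * (a + b) + (x + y)              ≡⟨ cong₂ (λ s t → c * s + t) ab xy ⟩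
    c * (a′ + 2 * b′) + (x′ + 2 * y′)  ≡⟨ undistribute c a′ b′ x′ y′ ⟩
    (c * a′ + x′) + 2 * (c * b′ + y′)  ∎
    where
    distribute : ∀ c a b x y → (c * a + x) + (c * b + y) ≡ c * (a + b) + (x + y)
    distribute = solve-∀
    undistribute : ∀ c a b x y → c * (a + 2 * b) + (x + 2 * y) ≡ (c * a + x) + 2 * (c * b + y)
    undistribute = solve-∀
  -- Peeling off the constant term of f reduces the claim for f to the claim for f ∘ suc.
  c₂₊ : ∀ f n → (f · u) (2 + n) + (f · u) n ≡ (f · v) (1 + n) + 2 * (f · u) (1 + n)
  c₂₊ f zero = begin
    (f · u) 2 + (f · u) 0
      ≡⟨ cong (_+ (f · u) 0) (·-suc f u 1) ⟩
    (f 0 * u 2 + ((f ∘ suc) · u) 1) + (f 0 * u 0 + 0)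
      ≡⟨ combine (f 0) _ _ _ _ _ _ _ _ (coeff₂₊ uv 0)
                 (cong₂ (λ a b → a + 2 * b) (c₁ (f ∘ suc)) (sym (c₀ (f ∘ suc)))) ⟩
    (f 0 * v 1 + ((f ∘ suc) · v) 0) + 2 * (f 0 * u 1 + ((f ∘ suc) · u) 0)
      ≡⟨ sym (cong₂ (λ a b → a + 2 * b) (·-suc f v 0) (·-suc f u 0)) ⟩
    (f · v) 1 + 2 * (f · u) 1 ∎
  c₂₊ f (suc n) = begin
    (f · u) (3 + n) + (f · u) (1 + n)
      ≡⟨ cong₂ _+_ (·-suc f u (2 + n)) (·-suc f u n) ⟩
    (f 0 * u (3 + n) + ((f ∘ suc) · u) (2 + n)) + (f 0 * u (1 + n) + ((f ∘ suc) · u) n)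
      ≡⟨ combine (f 0) _ _ _ _ _ _ _ _ (coeff₂₊ uv (suc n)) (c₂₊ (f ∘ suc) n) ⟩
    (f 0 * v (2 + n) + ((f ∘ suc) · v) (1 + n)) + 2 * (f 0 * u (2 + n) + ((f ∘ suc) · u) (1 + n))
      ≡⟨ sym (cong₂ (λ a b → a + 2 * b) (·-suc f v (1 + n)) (·-suc f u (1 + n))) ⟩
    (f · v) (2 + n) + 2 * (f · u) (2 + n) ∎

VanishesBelow : ℕ → Series → Set
VanishesBelow m u = ∀ i → i < m → u i ≡ 0

[1-x]²≡x·-vanishes : ∀ {u v m} → [1-x]² u ≡x· v → VanishesBelow m v → VanishesBelow (suc m) u
[1-x]²≡x·-vanishes uv v≈0 zero          _            = coeff₀ uv
[1-x]²≡x·-vanishes uv v≈0 (suc zero)    (s≤s 0<m)    = trans (coeff₁ uv) (v≈0 0 0<m)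
[1-x]²≡x·-vanishes {u} {v} uv v≈0 (suc (suc i)) (s≤s 1+i<m) = m+n≡0⇒m≡0 (u (2 + i)) (begin
  u (2 + i) + u i             ≡⟨ coeff₂₊ uv i ⟩
  v (1 + i) + 2 * u (1 + i)   ≡⟨ cong₂ (λ a b → a + 2 * b) (v≈0 (suc i) 1+i<m)
                                   ([1-x]²≡x·-vanishes uv v≈0 (suc i) (s≤s (<⇒≤ 1+i<m))) ⟩
  0                           ∎)
  where open ≡-Reasoning

[1-x]²≡x·-leading : ∀ {u v} m → [1-x]² u ≡x· v → VanishesBelow m v → u (suc m) ≡ v m
[1-x]²≡x·-leading zero    uv v≈0 = coeff₁ uv
[1-x]²≡x·-leading {u} {v} (suc m) uv v≈0 = begin
  u (2 + m)                 ≡⟨ sym (+-identityʳ _) ⟩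
  u (2 + m) + 0             ≡⟨ cong (u (2 + m) +_) (sym (u≈0 m (s≤s (n≤1+n m)))) ⟩
  u (2 + m) + u m           ≡⟨ coeff₂₊ uv m ⟩
  v (1 + m) + 2 * u (1 + m) ≡⟨ cong (λ z → v (1 + m) + 2 * z) (u≈0 (suc m) (n<1+n (suc m))) ⟩
  v (1 + m) + 0             ≡⟨ +-identityʳ _ ⟩
  v (1 + m)                 ∎
  where
  open ≡-Reasoning
  u≈0 = [1-x]²≡x·-vanishes uv v≈0

Rbar-column : ∀ m → [1-x]² (λ n → Rbar n (suc m)) ≡x· (λ n → Rbar n m)
Rbar-column m = ·-preserves-[1-x]²≡x· (geom · geom2) (xOver1mx2·-solves (pow xOver1mx2 m))

Rbar-vanishes : ∀ m → VanishesBelow m (λ n → Rbar n m)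
Rbar-vanishes zero    i ()
Rbar-vanishes (suc m) = [1-x]²≡x·-vanishes (Rbar-column m) (Rbar-vanishes m)

Rbar-diagonal : ∀ n → Rbar n n ≡ 1
Rbar-diagonal zero    = refl
Rbar-diagonal (suc n) = trans ([1-x]²≡x·-leading n (Rbar-column n) (Rbar-vanishes n)) (Rbar-diagonal n)

geom2≡evenBit : ∀ n → geom2 n ≡ evenBit n
geom2≡evenBit zero          = refl
geom2≡evenBit (suc zero)    = refl
geom2≡evenBit (suc (suc n)) = trans (cong (λ m → if ⌊ m ≟ 0 ⌋ then 1 else 0) 2+n%2≡n%2) (geom2≡evenBit n)
  where
  2+n%2≡n%2 : (2 + n) % 2 ≡ n % 2
  2+n%2≡n%2 = trans (cong (_% 2) (+-comm 2 n)) ([m+n]%n≡m%n n 2)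

Rbar-suc-zero : ∀ n → Rbar (suc n) 0 ≡ Rbar n 0 + oddBit n
Rbar-suc-zero n = begin
  Rbar (suc n) 0                          ≡⟨ ·-identityʳ (geom · geom2) (suc n) ⟩
  (geom · geom2) (suc n)                  ≡⟨ ·-suc geom geom2 n ⟩
  1 * geom2 (suc n) + (geom · geom2) n    ≡⟨ cong (_+ (geom · geom2) n) (trans (*-identityˡ _) (geom2≡evenBit (suc n))) ⟩
  oddBit n + (geom · geom2) n             ≡⟨ +-comm (oddBit n) _ ⟩
  (geom · geom2) n + oddBit n             ≡⟨ cong (_+ oddBit n) (sym (·-identityʳ (geom · geom2) n)) ⟩
  Rbar n 0 + oddBit n                     ∎
  where open ≡-Reasoning

-- Cut off to 0 for k > n, where there are no tilings either.
riordanRows : ℕ → ℕ → ℕ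
riordanRows n k = if does (k ≤? n) then Rbar n (n ∸ k) else 0

riordanRows-≤ : ∀ {n k} → k ≤ n → riordanRows n k ≡ Rbar n (n ∸ k)
riordanRows-≤ {n} {k} k≤n = cong (λ b → if b then Rbar n (n ∸ k) else 0) (dec-true (k ≤? n) k≤n)

riordanRows-> : ∀ {n k} → n < k → riordanRows n k ≡ 0
riordanRows-> {n} {k} n<k = cong (λ b → if b then Rbar n (n ∸ k) else 0) (dec-false (k ≤? n) (<⇒≱ n<k))

riordanRows-diagonal : ∀ n → riordanRows n n ≡ Rbar n 0
riordanRows-diagonal n = trans (riordanRows-≤ {n} ≤-refl) (cong (Rbar n) (n∸n≡0 n))

riordan-recurrence-below : ∀ {q j} → j < q → RowRecurrenceAt riordanRows q (2 + j)
riordan-recurrence-below {q} {j} j<q = begin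
  riordanRows (2 + q) (2 + j) + riordanRows q j + δ q j * oddBit q
    ≡⟨ cong₂ (λ x y → x + y + δ q j * oddBit q) (riordanRows-≤ (s≤s (s≤s (<⇒≤ j<q)))) (riordanRows-≤ (<⇒≤ j<q)) ⟩
  Rbar (2 + q) (q ∸ j) + Rbar q (q ∸ j) + δ q j * oddBit q
    ≡⟨ cong₂ _+_ (cong (λ i → Rbar (2 + q) i + Rbar q i) q∸j≡1+m) (cong (_* oddBit q) δ≡0) ⟩
  Rbar (2 + q) (1 + m) + Rbar q (1 + m) + 0
    ≡⟨ cong (_+ 0) (coeff₂₊ (Rbar-column m) q) ⟩
  Rbar (1 + q) m + 2 * Rbar (1 + q) (1 + m) + 0
    ≡⟨ sym (cong₂ _+_ (cong₂ (λ x y → x + 2 * y) (riordanRows-≤ (s≤s j<q))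
                                                  (trans (riordanRows-≤ (s≤s (<⇒≤ j<q))) (cong (Rbar (1 + q)) q∸j≡1+m)))
                      (cong (_* evenBit q) δ≡0)) ⟩
  riordanRows (1 + q) (2 + j) + 2 * riordanRows (1 + q) (1 + j) + δ q j * evenBit q ∎
  where
  open ≡-Reasoning
  m = q ∸ suc j
  q∸j≡1+m : q ∸ j ≡ 1 + m
  q∸j≡1+m = +-∸-assoc 1 j<q
  δ≡0 : δ q j ≡ 0
  δ≡0 = δ-≢ (>⇒≢ j<q)

riordan-recurrence-diagonal : ∀ j → RowRecurrenceAt riordanRows j (2 + j)
riordan-recurrence-diagonal j = begin
  riordanRows (2 + j) (2 + j) + riordanRows j j + δ j j * oddBit j
    ≡⟨ cong₂ _+_ (cong₂ _+_ (riordanRows-diagonal (2 + j)) (riordanRows-diagonal j)) (cong (_* oddBit j) (δ-diagonal j)) ⟩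
  Rbar (2 + j) 0 + Rbar j 0 + 1 * oddBit j
    ≡⟨ diagonal-step (Rbar-suc-zero (suc j)) (Rbar-suc-zero j) ⟩
  0 + 2 * Rbar (1 + j) 0 + 1 * evenBit j
    ≡⟨ sym (cong₂ _+_ (cong₂ (λ x y → x + 2 * y) (riordanRows-> (n<1+n (suc j))) (riordanRows-diagonal (1 + j)))
                      (cong (_* evenBit j) (δ-diagonal j))) ⟩
  riordanRows (1 + j) (2 + j) + 2 * riordanRows (1 + j) (1 + j) + δ j j * evenBit j ∎
  where
  open ≡-Reasoning
  diagonal-step : ∀ {a b c o e} → a ≡ b + e → b ≡ c + o → a + c + 1 * o ≡ 0 + 2 * b + 1 * e
  diagonal-step {c = c} {o} {e} refl refl = regroup c o e
    where
    regroup : ∀ c o e → c + o + e + c + 1 * o ≡ 0 + 2 * (c + o) + 1 * e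
    regroup = solve-∀

riordan-recurrence-above : ∀ {q j} → q < j → RowRecurrenceAt riordanRows q (2 + j)
riordan-recurrence-above {q} {j} q<j = trans
  (cong₂ _+_ (cong₂ _+_ (riordanRows-> (s≤s (s≤s q<j))) (riordanRows-> q<j)) (cong (_* oddBit q) δ≡0))
  (sym (cong₂ _+_ (cong₂ (λ x y → x + 2 * y) (riordanRows-> (s≤s (m<n⇒m<1+n q<j))) (riordanRows-> (s≤s q<j)))
                  (cong (_* evenBit q) δ≡0)))
  where
  δ≡0 : δ q j ≡ 0
  δ≡0 = δ-≢ (<⇒≢ q<j)

riordan-recurrence : RowRecurrence riordanRows
riordan-recurrence q zero = cong (λ x → x + 0 + 0) (trans (Rbar-diagonal (2 + q)) (sym (Rbar-diagonal (1 + q))))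
riordan-recurrence q (suc zero) = cong (_+ 0) (begin
  Rbar (2 + q) (1 + q) + 0                  ≡⟨ cong (Rbar (2 + q) (1 + q) +_) (sym (Rbar-vanishes (suc q) q (n<1+n q))) ⟩
  Rbar (2 + q) (1 + q) + Rbar q (1 + q)     ≡⟨ coeff₂₊ (Rbar-column q) q ⟩
  Rbar (1 + q) q + 2 * Rbar (1 + q) (1 + q) ∎)
  where open ≡-Reasoning
riordan-recurrence q (suc (suc j)) with <-cmp j q
... | tri< j<q _ _ = riordan-recurrence-below j<q
... | tri≈ _ refl _ = riordan-recurrence-diagonal j
... | tri> _ _ q<j = riordan-recurrence-above q<j

theorem6p10 : (n k : ℕ) → k ≤ n → T (2 * n + 1) k ≡ Rbar n (n ∸ k)
theorem6p10 n k k≤n = begin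
  T (2 * n + 1) k                         ≡⟨ T≡tilings (2 * n + 1) k ⟩
  tilings false false (2 * n + 1) k       ≡⟨ cong (λ N → tilings false false N k) (2n+1≡suc-double n) ⟩
  tilings false false (suc (double n)) k  ≡⟨ RowRecurrence-unique tilings-recurrence riordan-recurrence row₀ row₁ n k ⟩
  riordanRows n k                         ≡⟨ riordanRows-≤ k≤n ⟩
  Rbar n (n ∸ k)                          ∎
  where
  open ≡-Reasoning
  row₀ : ∀ k → tilings false false 1 k ≡ riordanRows 0 k
  row₀ zero    = refl
  row₀ (suc k) = refl
  row₁ : ∀ k → tilings false false 3 k ≡ riordanRows 1 k
  row₁ zero          = refl
  row₁ (suc zero)    = refl
  row₁ (suc (suc k)) = refl
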